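{- Let $\mathbf{D}=(d_{i,j})\in\mathbb{N}^{k\times n}$ be a tree degree matrix without common leaves. Suppose column $l$ of $\mathbf{D}$ has entry $1$ in row $i$ and entry $2$ in every other row, and suppose $d_{i,j}>2$ for some column $j\neq l$. Let $\mathbf{D}'\in\mathbb{N}^{k\times(n-1)}$ be obtained from $\mathbf{D}$ by deleting column $l$ and subtracting $1$ from the entry $d_{i,j}$, and assume $\mathbf{D}'$ is a tree degree matrix without common leaves. Let $G'$ be an arbitrary caterpillar realization of $\mathbf{D}'$ (with vertex $v_j$ corresponding to column $j$). For each row $r$, let $P^r$ be a path in the caterpillar of color $r$ consisting of its backbone together with two additional edges, each joining an arbitrary leaf to one of the two end vertices of the backbone. If $\bigcup_{r\neq i}P^r$ contains a rainbow matching of size $k-1$ none of whose edges is incident to $v_j$, then $\mathbf{D}$ has a caterpillar realization.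
   Context: A tree degree sequence $d_1,\dots,d_n$ is a sequence of positive integers with $\sum_j d_j=2n-2$. A $k\times n$ matrix is a tree degree matrix if each row is a tree degree sequence; it has no common leaves if each column contains at most one entry equal to $1$. A realization of a matrix $(d_{i,j})$ is a simple graph on vertices $v_1,\dots,v_n$ with edges colored by $k$ colors such that, for each $i$, the edges of color $i$ form a graph in which $v_j$ has degree $d_{i,j}$. A leaf is a vertex of degree $1$; a caterpillar is a tree whose non-leaf vertices form a path (the backbone). A caterpillar realization is a realization in which every color class is a (spanning) caterpillar. In an edge-colored graph, a rainbow matching of size $m$ is a matching with $m$ edges, no two of which have the same color. -}

module Defs where

open import Data.Nat using (ℕ; zero; suc; _+_; _*_; _∸_; _<_; _≤_)
open import Data.Fin using (Fin; punchIn)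
open import Data.Fin.Properties using (_≟_)
open import Data.Bool using (Bool; true; false; T; if_then_else_)
open import Data.Bool.Properties using (T?)
open import Data.List using (List; []; _∷_; _++_; length; map; filter; allFin)
open import Data.Nat.ListAction using (sum)
open import Data.List.Relation.Unary.Linked using (Linked)
open import Data.List.Relation.Unary.Unique.Propositional using (Unique)
open import Data.List.Membership.Propositional using (_∈_)
open import Data.Product using (Σ; _×_; ∃; ∃-syntax; _,_)
open import Data.Sum using (_⊎_)
open import Relation.Binary.PropositionalEquality using (_≡_; _≢_)
open import Relation.Nullary using (¬_; does)
open import Function.Bundles using (_⇔_)

Matrix : ℕ → ℕ → Set
Matrix k n = Fin k → Fin n → ℕ

-- A tree degree sequence: positive entries summing to 2n - 2
-- (written as  sum + 2 ≡ 2 n  to avoid truncated subtraction).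
TreeDegreeSeq : ∀ {n} → (Fin n → ℕ) → Set
TreeDegreeSeq {n} d = (∀ j → 1 ≤ d j) × (sum (map d (allFin n)) + 2 ≡ 2 * n)

TreeDegreeMatrix : ∀ {k n} → Matrix k n → Set
TreeDegreeMatrix D = ∀ i → TreeDegreeSeq (D i)

NoCommonLeaves : ∀ {k n} → Matrix k n → Set
NoCommonLeaves D = ∀ j r s → D r j ≡ 1 → D s j ≡ 1 → r ≡ s

-- D' : delete column l, subtract 1 from entry (i , j) where j = punchIn l j'.
delCol : ∀ {k m} → Matrix k (suc m) → Fin (suc m) → Fin k → Fin m → Matrix k m
delCol D l i j' r c =
  D r (punchIn l c) ∸ (if does (r ≟ i) then (if does (c ≟ j') then 1 else 0) else 0)

Graph : ℕ → Set
Graph n = Fin n → Fin n → Bool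

Adj : ∀ {n} → Graph n → Fin n → Fin n → Set
Adj E u v = T (E u v)

deg : ∀ {n} → Graph n → Fin n → ℕ
deg {n} E u = length (filter (λ v → T? (E u v)) (allFin n))

Leaf : ∀ {n} → Graph n → Fin n → Set
Leaf E v = deg E v ≡ 1

IsSimpleGraph : ∀ {n} → Graph n → Set
IsSimpleGraph E = (∀ u → ¬ Adj E u u) × (∀ u v → E u v ≡ E v u)

data Walk {n} (E : Graph n) : Fin n → Fin n → Set where
  stop : ∀ {u} → Walk E u u
  step : ∀ {u v w} → Adj E u v → Walk E v w → Walk E u w

Connected : ∀ {n} → Graph n → Set
Connected E = ∀ u v → Walk E u v

IsCycle : ∀ {n} → Graph n → Fin n → List (Fin n) → Set
IsCycle E x rest =
  (2 ≤ length rest) × Unique (x ∷ rest) × Linked (Adj E) (x ∷ rest ++ x ∷ [])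

Acyclic : ∀ {n} → Graph n → Set
Acyclic E = ∀ x rest → ¬ IsCycle E x rest

IsTree : ∀ {n} → Graph n → Set
IsTree E = IsSimpleGraph E × Connected E × Acyclic E

IsBackbone : ∀ {n} → Graph n → List (Fin n) → Set
IsBackbone E bb =
  Unique bb × Linked (Adj E) bb × (∀ v → (v ∈ bb) ⇔ (¬ Leaf E v))

IsCaterpillar : ∀ {n} → Graph n → Set
IsCaterpillar E = IsTree E × ∃[ bb ] IsBackbone E bb

ColouredGraph : ℕ → ℕ → Set
ColouredGraph k n = Fin k → Graph n

IsSimpleColoured : ∀ {k n} → ColouredGraph k n → Set
IsSimpleColoured G =
  (∀ r → IsSimpleGraph (G r)) ×
  (∀ r s u v → Adj (G r) u v → Adj (G s) u v → r ≡ s)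

Realization : ∀ {k n} → Matrix k n → ColouredGraph k n → Set
Realization D G = IsSimpleColoured G × (∀ r v → deg (G r) v ≡ D r v)

CaterpillarRealization : ∀ {k n} → Matrix k n → ColouredGraph k n → Set
CaterpillarRealization D G = Realization D G × (∀ r → IsCaterpillar (G r))

-- The path P^r: backbone extended at both ends by an edge to a leaf.
-- As a vertex list: a ∷ bb ++ [ b ], with a, b leaves, bb a backbone,
-- all vertices distinct, consecutive vertices adjacent.

IsSpinePath : ∀ {n} → Graph n → List (Fin n) → Set
IsSpinePath E p =
  Σ _ λ a → Σ _ λ bb → Σ _ λ b →
    (p ≡ a ∷ bb ++ b ∷ []) × Leaf E a × Leaf E b × IsBackbone E bb ×
    Unique p × Linked (Adj E) p

data Consec {A : Set} : List A → A → A → Set where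
  here  : ∀ {x y xs} → Consec (x ∷ y ∷ xs) x y
  there : ∀ {x y z xs} → Consec xs y z → Consec (x ∷ xs) y z

PathEdge : ∀ {A : Set} → List A → A → A → Set
PathEdge p u v = Consec p u v ⊎ Consec p v u

record RainbowMatching {k n} (P : Fin k → List (Fin n)) (i : Fin k)
                       (w : Fin n) (s : ℕ) : Set where
  field
    col     : Fin s → Fin k
    end₁    : Fin s → Fin n
    end₂    : Fin s → Fin n
    colOk   : ∀ t → col t ≢ i
    inPath  : ∀ t → PathEdge (P (col t)) (end₁ t) (end₂ t)
    avoid₁  : ∀ t → end₁ t ≢ w
    avoid₂  : ∀ t → end₂ t ≢ w
    rainbow : ∀ t t' → col t ≡ col t' → t ≡ t'
    disj₁₁  : ∀ t t' → end₁ t ≡ end₁ t' → t ≡ t'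
    disj₂₂  : ∀ t t' → end₂ t ≡ end₂ t' → t ≡ t'
    disj₁₂  : ∀ t t' → end₁ t ≢ end₂ t'

-- In every colour class of G′ the new vertex l is inserted. In colour i it becomes a
-- pendant leaf at v_j, raising d_{i,j} by one; since d′_{i,j} ≥ 2, v_j is already on the
-- backbone, which is unchanged. In every colour r ≠ i, l subdivides the edge of colour r
-- of the rainbow matching; that edge lies on P^r, so l joins the backbone of colour r and
-- old degrees are unchanged. Acyclicity survives because a detour around an edge of the
-- new graph contracts, by merging l into a neighbour, to a detour in the old tree. Colour
-- classes stay edge-disjoint since the edges at l go to v_j in colour i and to the ends
-- of the matching edges otherwise, and these ends are pairwise distinct and avoid v_j.

module Submission where

open import Defs
open import Data.Nat using (ℕ; zero; suc; _+_; _∸_; _<_; _≤_; s≤s; z≤n)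
open import Data.Nat.Properties
  using (+-suc; +-commutativeSemigroup; n<1+n; m+[n∸m]≡n; m≤n⇒m≤1+n; ∸-monoˡ-≤; ≤-refl)
open import Algebra.Properties.CommutativeSemigroup +-commutativeSemigroup using (x∙yz≈y∙xz)
open import Data.Fin using (Fin; zero; suc; punchIn; punchOut)
open import Data.Fin.Properties
  using (_≟_; punchInᵢ≢i; punchIn-injective; punchOut-cong; punchOut-injective;
         punchIn-punchOut; punchOut-punchIn; pigeonhole; <⇒≢; suc-injective)
open import Data.Bool using (Bool; true; false; T; _∧_; not; if_then_else_)
open import Data.Bool.Properties using (T?; T-≡; ∧-zeroʳ; ∧-identityʳ)
open import Data.List using (List; []; _∷_; _++_; length; map; filter; tabulate)
open import Data.List.Properties using (map-++; ++-assoc)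
open import Data.List.Relation.Unary.Linked using (Linked; []; [-]; _∷_)
import Data.List.Relation.Unary.Linked as Linked
import Data.List.Relation.Unary.Linked.Properties as Linkedₚ
open import Data.List.Relation.Unary.All using (All; []; _∷_)
import Data.List.Relation.Unary.All as All
open import Data.List.Relation.Unary.All.Properties using (¬Any⇒All¬)
open import Data.List.Relation.Unary.Any using (here; there; any?)
open import Data.List.Relation.Unary.AllPairs using ([]; _∷_)
open import Data.List.Relation.Unary.Unique.Propositional using (Unique)
import Data.List.Relation.Unary.Unique.Propositional.Properties as Unique
open import Data.List.Membership.Propositional using (_∈_; _∉_)
open import Data.List.Membership.Propositional.Properties using (∈-map⁺; ∈-map⁻; ∈-++⁺ˡ; ∈-++⁺ʳ)
open import Data.List.Relation.Binary.Permutation.Propositional using (_↭_; ↭-sym; ↭⇒↭ₛ)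
open import Data.List.Relation.Binary.Permutation.Propositional.Properties using (shift; ∈-resp-↭)
import Data.List.Relation.Binary.Permutation.Setoid.Properties as PermutationSetoid
open import Data.Product using (_×_; ∃-syntax; _,_; proj₁; proj₂)
open import Data.Sum using (_⊎_; inj₁; inj₂; [_,_])
open import Data.Empty using (⊥-elim)
open import Data.Unit using (tt)
open import Function using (_∘_; id)
open import Function.Bundles using (_⇔_; mk⇔; Equivalence)
open import Relation.Binary.Construct.Closure.ReflexiveTransitive
  using (Star; ε; _◅_; _◅◅_; kleisliStar; reverse)
open import Relation.Binary.PropositionalEquality
  using (_≡_; _≢_; refl; sym; trans; cong; cong₂; subst; subst₂; setoid; module ≡-Reasoning)
open import Relation.Nullary using (¬_; Dec; yes; no; does)
open import Relation.Nullary.Decidable using (dec-true; dec-false; _×-dec_; _⊎-dec_)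

open Equivalence using (to; from)

does-witness : ∀ {A : Set} (a? : Dec A) → T (does a?) → A
does-witness (yes a) _ = a

does-intro : ∀ {A : Set} (a? : Dec A) → A → T (does a?)
does-intro a? a = subst T (sym (dec-true a? a)) tt

2≤⇒≢1 : ∀ {n} → 2 ≤ n → n ≢ 1
2≤⇒≢1 (s≤s ()) refl

bit : Bool → ℕ
bit b = if b then 1 else 0

bit+∸bit : ∀ b {n} → 1 ≤ n → bit b + (n ∸ bit b) ≡ n
bit+∸bit true  1≤n = m+[n∸m]≡n 1≤n
bit+∸bit false _   = refl

count : ∀ {n} → (Fin n → Bool) → ℕ
count {zero}  f = 0
count {suc n} f = bit (f zero) + count (f ∘ suc)

length-filter-tabulate : ∀ {n N} (g : Fin n → Fin N) (f : Fin N → Bool) →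
  length (filter (λ v → T? (f v)) (tabulate g)) ≡ count (f ∘ g)
length-filter-tabulate {zero}  g f = refl
length-filter-tabulate {suc n} g f with f (g zero)
... | true  = cong suc (length-filter-tabulate (g ∘ suc) f)
... | false = length-filter-tabulate (g ∘ suc) f

deg≡count : ∀ {n} (E : Graph n) u → deg E u ≡ count (E u)
deg≡count E u = length-filter-tabulate id (E u)

count-ext : ∀ {n} {f g : Fin n → Bool} → (∀ x → f x ≡ g x) → count f ≡ count g
count-ext {zero}  e = refl
count-ext {suc n} e = cong₂ _+_ (cong bit (e zero)) (count-ext (e ∘ suc))

count-punchIn : ∀ {m} (l : Fin (suc m)) (f : Fin (suc m) → Bool) →
  count f ≡ bit (f l) + count (f ∘ punchIn l)
count-punchIn          zero    f = refl
count-punchIn {suc m} (suc l) f = begin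
  bit (f zero) + count (f ∘ suc)
    ≡⟨ cong (bit (f zero) +_) (count-punchIn l (f ∘ suc)) ⟩
  bit (f zero) + (bit (f (suc l)) + count (f ∘ suc ∘ punchIn l))
    ≡⟨ x∙yz≈y∙xz (bit (f zero)) (bit (f (suc l))) _ ⟩
  bit (f (suc l)) + (bit (f zero) + count (f ∘ suc ∘ punchIn l)) ∎
  where open ≡-Reasoning

count-drop : ∀ {n} {f g : Fin n → Bool} (p : Fin n) → f p ≡ true → g p ≡ false →
  (∀ q → q ≢ p → f q ≡ g q) → count f ≡ suc (count g)
count-drop {suc n} zero fp gp e rewrite fp | gp = cong suc (count-ext (λ q → e (suc q) λ ()))
count-drop {suc n} {f} {g} (suc p) fp gp e
  rewrite e zero (λ ())
        | count-drop {f = f ∘ suc} {g ∘ suc} p fp gp (λ q q≢p → e (suc q) (q≢p ∘ suc-injective))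
  = +-suc (bit (g zero)) _

count-false : ∀ {n} → count {n} (λ _ → false) ≡ 0
count-false {zero}  = refl
count-false {suc n} = count-false {n}

count-≟ : ∀ {n} (x : Fin n) → count (λ d → does (d ≟ x)) ≡ 1
count-≟ {n} x = trans
  (count-drop x (dec-true (x ≟ x) refl) refl (λ q q≢x → dec-false (q ≟ x) q≢x))
  (cong suc (count-false {n}))

count-≟-⊎ : ∀ {n} {x y : Fin n} → x ≢ y → count (λ d → does ((d ≟ x) ⊎-dec (d ≟ y))) ≡ 2
count-≟-⊎ {x = x} {y} x≢y = trans
  (count-drop x (dec-true ((x ≟ x) ⊎-dec (x ≟ y)) (inj₁ refl)) (dec-false (x ≟ y) x≢y) drop-x)
  (cong suc (count-≟ y))
  where
  drop-x : ∀ q → q ≢ x → does ((q ≟ x) ⊎-dec (q ≟ y)) ≡ does (q ≟ y)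
  drop-x q q≢x rewrite dec-false (q ≟ x) q≢x = refl

-- Walks, detours and acyclicity

Reach : ∀ {n} → Graph n → Fin n → Fin n → Set
Reach E = Star (Adj E)

walk⇒reach : ∀ {n} {E : Graph n} {u v} → Walk E u v → Reach E u v
walk⇒reach stop       = ε
walk⇒reach (step a w) = a ◅ walk⇒reach w

reach⇒walk : ∀ {n} {E : Graph n} {u v} → Reach E u v → Walk E u v
reach⇒walk ε       = stop
reach⇒walk (a ◅ w) = step a (reach⇒walk w)

adj-sym : ∀ {n} {E : Graph n} → IsSimpleGraph E → ∀ {u v} → Adj E u v → Adj E v u
adj-sym (_ , sym-E) {u} {v} = subst T (sym-E u v)

star-from-sink : ∀ {A : Set} {R : A → A → Set} {z x} → (∀ w → ¬ R z w) → Star R z x → z ≡ x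
star-from-sink _    ε       = refl
star-from-sink sink (r ◅ _) = ⊥-elim (sink _ r)

SameEdge : ∀ {A : Set} → A → A → A → A → Set
SameEdge a b p q = (p ≡ a × q ≡ b) ⊎ (p ≡ b × q ≡ a)

sameEdge? : ∀ {n} (a b p q : Fin n) → Dec (SameEdge a b p q)
sameEdge? a b p q = ((p ≟ a) ×-dec (q ≟ b)) ⊎-dec ((p ≟ b) ×-dec (q ≟ a))

SameEdge-swap : ∀ {A : Set} {a b p q : A} → SameEdge a b p q → SameEdge a b q p
SameEdge-swap (inj₁ (p≡a , q≡b)) = inj₂ (q≡b , p≡a)
SameEdge-swap (inj₂ (p≡b , q≡a)) = inj₁ (q≡a , p≡b)

SameEdge-sym : ∀ {A : Set} {a b p q : A} → SameEdge a b p q → SameEdge p q a b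
SameEdge-sym (inj₁ (refl , refl)) = inj₁ (refl , refl)
SameEdge-sym (inj₂ (refl , refl)) = inj₂ (refl , refl)

SameEdge-flip : ∀ {A : Set} {a b p q : A} → SameEdge b a p q → SameEdge a b p q
SameEdge-flip (inj₁ s) = inj₂ s
SameEdge-flip (inj₂ s) = inj₁ s

SameEdge-trans : ∀ {A : Set} {a b c d p q : A} → SameEdge a b c d → SameEdge c d p q → SameEdge a b p q
SameEdge-trans (inj₁ (refl , refl)) s = s
SameEdge-trans (inj₂ (refl , refl)) s = SameEdge-flip s

SameEdge-map : ∀ {A B : Set} (f : A → B) {a b p q} → SameEdge a b p q → SameEdge (f a) (f b) (f p) (f q)
SameEdge-map f (inj₁ (refl , refl)) = inj₁ (refl , refl)
SameEdge-map f (inj₂ (refl , refl)) = inj₂ (refl , refl)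

SameEdge-first : ∀ {A : Set} {a b p q : A} → SameEdge a b p q → p ≡ a ⊎ p ≡ b
SameEdge-first (inj₁ (p≡a , _)) = inj₁ p≡a
SameEdge-first (inj₂ (p≡b , _)) = inj₂ p≡b

SameEdge-endpoint : ∀ {A : Set} {a b p q w : A} → w ≡ a ⊎ w ≡ b → w ≢ p → w ≢ q →
  ¬ SameEdge a b p q
SameEdge-endpoint (inj₁ refl) w≢p _   (inj₁ (p≡w , _)) = w≢p (sym p≡w)
SameEdge-endpoint (inj₁ refl) _   w≢q (inj₂ (_ , q≡w)) = w≢q (sym q≡w)
SameEdge-endpoint (inj₂ refl) _   w≢q (inj₁ (_ , q≡w)) = w≢q (sym q≡w)
SameEdge-endpoint (inj₂ refl) w≢p _   (inj₂ (p≡w , _)) = w≢p (sym p≡w)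

SameEdge-other-end : ∀ {A : Set} {a b p q e : A} → SameEdge a b p q → e ≡ a ⊎ e ≡ b → e ≢ q →
  e ≡ p
SameEdge-other-end (inj₁ (refl , refl)) (inj₁ refl) _   = refl
SameEdge-other-end (inj₁ (refl , refl)) (inj₂ refl) e≢q = ⊥-elim (e≢q refl)
SameEdge-other-end (inj₂ (refl , refl)) (inj₁ refl) e≢q = ⊥-elim (e≢q refl)
SameEdge-other-end (inj₂ (refl , refl)) (inj₂ refl) _   = refl

AvoidEdge : ∀ {n} → Graph n → Fin n → Fin n → Fin n → Fin n → Set
AvoidEdge E a b p q = Adj E p q × ¬ SameEdge a b p q

-- In a forest, an edge ab is the only way from a to b.
NoDetour : ∀ {n} → Graph n → Set
NoDetour E = ∀ {a b} → Adj E a b → ¬ Star (AvoidEdge E a b) a b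

reverse-detour : ∀ {n} {E : Graph n} → IsSimpleGraph E → ∀ {a b} →
  Star (AvoidEdge E a b) a b → Star (AvoidEdge E b a) b a
reverse-detour simple = reverse λ (e , ¬s) → adj-sym simple e , ¬s ∘ SameEdge-swap ∘ SameEdge-flip

data Chain {A : Set} (R : A → A → Set) : A → A → List A → Set where
  []  : ∀ {u} → Chain R u u []
  _∷_ : ∀ {u v w vs} → R u v → Chain R v w vs → Chain R u w (v ∷ vs)

chain-suffix : ∀ {n} {R : Fin n → Fin n → Set} {u v w vs} → Chain R v w vs → Unique (v ∷ vs) →
  u ∈ v ∷ vs → ∃[ ws ] Chain R u w ws × Unique (u ∷ ws)
chain-suffix ch         un        (here refl) = _ , ch , un
chain-suffix (_ ∷ ch) (_ ∷ un) (there u∈vs) = chain-suffix ch un u∈vs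

loop-erase : ∀ {n} {R : Fin n → Fin n → Set} {u w} → Star R u w →
  ∃[ ws ] Chain R u w ws × Unique (u ∷ ws)
loop-erase ε = [] , [] , [] ∷ []
loop-erase {u = u} (_◅_ {j = v} r rest) with loop-erase rest
... | vs , ch , un with any? (u ≟_) (v ∷ vs)
...   | yes u∈ = chain-suffix ch un u∈
...   | no  u∉ = v ∷ vs , r ∷ ch , ¬Any⇒All¬ (v ∷ vs) u∉ ∷ un

chain-map : ∀ {A : Set} {R S : A → A → Set} → (∀ {x y} → R x y → S x y) →
  ∀ {u w vs} → Chain R u w vs → Chain S u w vs
chain-map f []       = []
chain-map f (r ∷ ch) = f r ∷ chain-map f ch

chain-close : ∀ {A : Set} {R : A → A → Set} {u w z vs} → Chain R u w vs → R w z →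
  Linked R (u ∷ vs ++ z ∷ [])
chain-close []       r′ = r′ ∷ [-]
chain-close (r ∷ ch) r′ = r ∷ chain-close ch r′

-- Loop erasure of a detour for the edge ab, closed up by ab, is a cycle.
acyclic⇒noDetour : ∀ {n} {E : Graph n} → IsSimpleGraph E → Acyclic E → NoDetour E
acyclic⇒noDetour {E = E} simple@(loopless , _) acyclic {a} {b} a~b detour with loop-erase detour
... | []           , []                 , _  = loopless a a~b
... | v ∷ []       , (_ , ¬ab) ∷ []     , _  = ¬ab (inj₁ (refl , refl))
... | v ∷ v′ ∷ vs , ch                 , un =
  acyclic a (v ∷ v′ ∷ vs) (s≤s (s≤s z≤n) , un , chain-close (chain-map proj₁ ch) (adj-sym simple a~b))

avoiding-path : ∀ {n} {E : Graph n} {x y p} ps → Linked (Adj E) (p ∷ ps ++ x ∷ []) →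
  All (x ≢_) (p ∷ ps) → All (y ≢_) (p ∷ ps) → Star (AvoidEdge E y x) p x
avoiding-path {E = E} {x} {y} ps lk x∉ y∉ = go ps lk x∉ y∉
  where
  avoid : ∀ {p q} → x ≢ p → y ≢ p → ¬ SameEdge y x p q
  avoid x≢p _   (inj₂ (p≡x , _)) = x≢p (sym p≡x)
  avoid _   y≢p (inj₁ (p≡y , _)) = y≢p (sym p≡y)
  go : ∀ {p} ps → Linked (Adj E) (p ∷ ps ++ x ∷ []) → All (x ≢_) (p ∷ ps) →
    All (y ≢_) (p ∷ ps) → Star (AvoidEdge E y x) p x
  go []       (e ∷ [-]) (x≢p ∷ []) (y≢p ∷ []) = (e , avoid x≢p y≢p) ◅ ε
  go (q ∷ qs) (e ∷ lk)  (x≢p ∷ x∉) (y≢p ∷ y∉) = (e , avoid x≢p y≢p) ◅ go qs lk x∉ y∉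

-- Dropping the edge yx from a cycle x y z … leaves a detour y z … x.
noDetour⇒acyclic : ∀ {n} {E : Graph n} → IsSimpleGraph E → NoDetour E → Acyclic E
noDetour⇒acyclic _ noDetour x []      (() , _)
noDetour⇒acyclic _ noDetour x (y ∷ []) (s≤s () , _)
noDetour⇒acyclic simple noDetour x (y ∷ z ∷ rest)
  (_ , ((x≢y ∷ x≢z ∷ x∉) ∷ (y∉ ∷ _)) , (x~y ∷ y~z ∷ lk)) =
  noDetour (adj-sym simple x~y) ((y~z , ¬yx) ◅ avoiding-path rest lk (x≢z ∷ x∉) y∉)
  where
  ¬yx : ¬ SameEdge y x y z
  ¬yx (inj₁ (_ , z≡x)) = x≢z (sym z≡x)
  ¬yx (inj₂ (y≡x , _)) = x≢y (sym y≡x)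

LastOf : ∀ {A : Set} → A → List A → A → Set
LastOf a []       s = a ≡ s
LastOf a (c ∷ cs) s = LastOf c cs s

FirstOf : ∀ {A : Set} → List A → A → A → Set
FirstOf []      b t = b ≡ t
FirstOf (c ∷ _) b t = c ≡ t

consec-split : ∀ {A : Set} {a b s t : A} bb → Consec (a ∷ bb ++ b ∷ []) s t →
  ∃[ B₁ ] ∃[ B₂ ] bb ≡ B₁ ++ B₂ × LastOf a B₁ s × FirstOf B₂ b t
consec-split []       here              = [] , [] , refl , refl , refl
consec-split []       (there (there ()))
consec-split (c ∷ cs) here              = [] , c ∷ cs , refl , refl , refl
consec-split (c ∷ cs) (there st) with consec-split cs st
... | B₁ , B₂ , refl , last , first = c ∷ B₁ , B₂ , refl , last , first

LastOf-∈ : ∀ {A : Set} {a s : A} B → LastOf a B s → s ∈ a ∷ B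
LastOf-∈ []      refl = here refl
LastOf-∈ (c ∷ B) last = there (LastOf-∈ B last)

FirstOf-∈ : ∀ {A : Set} {b t : A} B → FirstOf B b t → t ∈ B ++ b ∷ []
FirstOf-∈ []      refl = here refl
FirstOf-∈ (c ∷ B) refl = here refl

consec-linked : ∀ {A : Set} {R : A → A → Set} {xs s t} → Consec xs s t → Linked R xs → R s t
consec-linked here       (r ∷ _)  = r
consec-linked (there st) (_ ∷ lk) = consec-linked st lk
consec-linked (there ()) [-]

unique-++-disjoint : ∀ {A : Set} (X : List A) {Y p q} → Unique (X ++ Y) → p ∈ X → q ∈ Y → p ≢ q
unique-++-disjoint (z ∷ X) (z∉ ∷ _) (here refl) q∈Y = All.lookup z∉ (∈-++⁺ʳ X q∈Y)
unique-++-disjoint (z ∷ X) (_ ∷ un) (there p∈X) q∈Y = unique-++-disjoint X un p∈X q∈Y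

linked-++⁻ˡ : ∀ {A : Set} {R : A → A → Set} (X : List A) {Y} → Linked R (X ++ Y) → Linked R X
linked-++⁻ˡ []          _        = []
linked-++⁻ˡ (a ∷ [])    _        = [-]
linked-++⁻ˡ (a ∷ b ∷ X) (r ∷ lk) = r ∷ linked-++⁻ˡ (b ∷ X) lk

linked-++⁻ʳ : ∀ {A : Set} {R : A → A → Set} (X : List A) {Y} → Linked R (X ++ Y) → Linked R Y
linked-++⁻ʳ []      lk = lk
linked-++⁻ʳ (a ∷ X) lk = linked-++⁻ʳ X (Linked.tail lk)

linked-join : ∀ {A : Set} {R : A → A → Set} (X : List A) {z Y} →
  Linked R (X ++ z ∷ []) → Linked R (z ∷ Y) → Linked R (X ++ z ∷ Y)
linked-join []          _        lk = lk
linked-join (a ∷ [])    (r ∷ [-]) lk = r ∷ lk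
linked-join (a ∷ b ∷ X) (r ∷ lk′) lk = r ∷ linked-join (b ∷ X) lk′ lk

unique-resp-↭ : ∀ {A : Set} {xs ys : List A} → xs ↭ ys → Unique xs → Unique ys
unique-resp-↭ {A} p = PermutationSetoid.Unique-resp-↭ (setoid A) (↭⇒↭ₛ p)

orient : ∀ {A : Set} {P : List A} {x y} → PathEdge P x y → ∃[ s ] ∃[ t ] SameEdge x y s t × Consec P s t
orient (inj₁ xy) = _ , _ , inj₁ (refl , refl) , xy
orient (inj₂ yx) = _ , _ , inj₂ (refl , refl) , yx

-- Adding a vertex l with neighbourhood L to a graph on the other vertices

module Extension {m : ℕ} (l : Fin (suc m)) where

  ι : Fin m → Fin (suc m)
  ι = punchIn l

  ι≢l : ∀ c → ι c ≢ l
  ι≢l = punchInᵢ≢i l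

  ι-injective : ∀ {c d} → ι c ≡ ι d → c ≡ d
  ι-injective = punchIn-injective l _ _

  data View : Fin (suc m) → Set where
    new : View l
    old : ∀ c → View (ι c)

  view : ∀ x → View x
  view x with l ≟ x
  ... | yes refl = new
  ... | no  l≢x  rewrite sym (punchIn-punchOut l≢x) = old (punchOut l≢x)

  punchOut-ι : ∀ {d} (l≢ιd : l ≢ ι d) → punchOut l≢ιd ≡ d
  punchOut-ι l≢ιd = trans (punchOut-cong l refl) (punchOut-punchIn l)

  ext : Graph m → (Fin m → Bool) → Graph (suc m)
  ext E L x y with l ≟ x | l ≟ y
  ... | yes _   | yes _   = false
  ... | yes _   | no l≢y = L (punchOut l≢y)
  ... | no l≢x | yes _   = L (punchOut l≢x)
  ... | no l≢x | no l≢y = E (punchOut l≢x) (punchOut l≢y)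

  module _ (E : Graph m) (L : Fin m → Bool) where

    ext-ll : ext E L l l ≡ false
    ext-ll with l ≟ l
    ... | yes _  = refl
    ... | no l≢l = ⊥-elim (l≢l refl)

    ext-lι : ∀ d → ext E L l (ι d) ≡ L d
    ext-lι d with l ≟ l | l ≟ ι d
    ... | no l≢l | _        = ⊥-elim (l≢l refl)
    ... | yes _  | yes l≡ιd = ⊥-elim (ι≢l d (sym l≡ιd))
    ... | yes _  | no l≢ιd  = cong L (punchOut-ι l≢ιd)

    ext-ιl : ∀ d → ext E L (ι d) l ≡ L d
    ext-ιl d with l ≟ ι d | l ≟ l
    ... | _        | no l≢l = ⊥-elim (l≢l refl)
    ... | yes l≡ιd | yes _  = ⊥-elim (ι≢l d (sym l≡ιd))
    ... | no l≢ιd  | yes _  = cong L (punchOut-ι l≢ιd)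

    ext-ιι : ∀ c d → ext E L (ι c) (ι d) ≡ E c d
    ext-ιι c d with l ≟ ι c | l ≟ ι d
    ... | yes l≡ιc | _        = ⊥-elim (ι≢l c (sym l≡ιc))
    ... | no _     | yes l≡ιd = ⊥-elim (ι≢l d (sym l≡ιd))
    ... | no l≢ιc  | no l≢ιd  = cong₂ E (punchOut-ι l≢ιc) (punchOut-ι l≢ιd)

    ext-simple : IsSimpleGraph E → IsSimpleGraph (ext E L)
    ext-simple (loopless , symmetric) = loopless′ , symmetric′
      where
      loopless′ : ∀ u → ¬ Adj (ext E L) u u
      loopless′ u with view u
      ... | new   = subst T ext-ll
      ... | old c = loopless c ∘ subst T (ext-ιι c c)
      symmetric′ : ∀ u v → ext E L u v ≡ ext E L v u
      symmetric′ u v with view u | view v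
      ... | new   | new   = refl
      ... | new   | old d = trans (ext-lι d) (sym (ext-ιl d))
      ... | old c | new   = trans (ext-ιl c) (sym (ext-lι c))
      ... | old c | old d = trans (ext-ιι c d) (trans (symmetric c d) (sym (ext-ιι d c)))

    deg-ext-l : deg (ext E L) l ≡ count L
    deg-ext-l = begin
      deg (ext E L) l                            ≡⟨ deg≡count (ext E L) l ⟩
      count (ext E L l)                          ≡⟨ count-punchIn l (ext E L l) ⟩
      bit (ext E L l l) + count (ext E L l ∘ ι)  ≡⟨ cong₂ _+_ (cong bit ext-ll) (count-ext ext-lι) ⟩
      count L                                    ∎
      where open ≡-Reasoning

    deg-ext-ι : ∀ c → deg (ext E L) (ι c) ≡ bit (L c) + deg E c
    deg-ext-ι c = begin
      deg (ext E L) (ι c)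
        ≡⟨ deg≡count (ext E L) (ι c) ⟩
      count (ext E L (ι c))
        ≡⟨ count-punchIn l (ext E L (ι c)) ⟩
      bit (ext E L (ι c) l) + count (ext E L (ι c) ∘ ι)
        ≡⟨ cong₂ _+_ (cong bit (ext-ιl c)) (count-ext (ext-ιι c)) ⟩
      bit (L c) + count (E c)
        ≡⟨ cong (bit (L c) +_) (deg≡count E c) ⟨
      bit (L c) + deg E c ∎
      where open ≡-Reasoning

    -- E may be E₀ with some edges removed, provided each is bypassed through l.
    ext-connected : ∀ {E₀ : Graph m} (w : Fin m) → T (L w) → Connected E₀ →
      (∀ {c d} → Adj E₀ c d → Reach (ext E L) (ι c) (ι d)) → Connected (ext E L)
    ext-connected w Lw connected lift u v = reach⇒walk (reach u v)
      where
      old-reach : ∀ c d → Reach (ext E L) (ι c) (ι d)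
      old-reach c d = kleisliStar ι lift (walk⇒reach (connected c d))
      l~ιw : Adj (ext E L) l (ι w)
      l~ιw = subst T (sym (ext-lι w)) Lw
      ιw~l : Adj (ext E L) (ι w) l
      ιw~l = subst T (sym (ext-ιl w)) Lw
      reach : ∀ u v → Reach (ext E L) u v
      reach u v with view u | view v
      ... | new   | new   = ε
      ... | new   | old d = l~ιw ◅ old-reach w d
      ... | old c | new   = old-reach c w ◅◅ (ιw~l ◅ ε)
      ... | old c | old d = old-reach c d

  squash : Fin m → Fin (suc m) → Fin m
  squash z x with l ≟ x
  ... | yes _   = z
  ... | no l≢x = punchOut l≢x

  squash-l : ∀ z → squash z l ≡ z
  squash-l z with l ≟ l
  ... | yes _  = refl
  ... | no l≢l = ⊥-elim (l≢l refl)

  squash-ι : ∀ z c → squash z (ι c) ≡ c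
  squash-ι z c with l ≟ ι c
  ... | yes l≡ιc = ⊥-elim (ι≢l c (sym l≡ιc))
  ... | no l≢ιc  = punchOut-ι l≢ιc

  squash-star : ∀ {R : Fin (suc m) → Fin (suc m) → Set} {S : Fin m → Fin m → Set} (z : Fin m) →
    (∀ {u v} → R u v → R v u) → (∀ {u v} → S u v → S v u) → ¬ R l l →
    (∀ {e} → R l (ι e) → e ≡ z ⊎ S z e) → (∀ {e f} → R (ι e) (ι f) → S e f) →
    ∀ {u v} → Star R u v → Star S (squash z u) (squash z v)
  squash-star {R} {S} z sym-R sym-S irreflexive at-l between = kleisliStar (squash z) squash-step
    where
    from-l : ∀ {e} → R l (ι e) → Star S z e
    from-l r with at-l r
    ... | inj₁ refl = ε
    ... | inj₂ s    = s ◅ ε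
    squash-step : ∀ {u v} → R u v → Star S (squash z u) (squash z v)
    squash-step {u} {v} r with view u | view v
    ... | new   | new   = ⊥-elim (irreflexive r)
    ... | new   | old e rewrite squash-l z | squash-ι z e = from-l r
    ... | old e | new   rewrite squash-l z | squash-ι z e = reverse sym-S (from-l (sym-R r))
    ... | old e | old f rewrite squash-ι z e | squash-ι z f = between r ◅ ε

  noDetour-by-cases : ∀ {N : Graph (suc m)} → IsSimpleGraph N →
    (∀ {d} → Adj N l (ι d) → ¬ Star (AvoidEdge N l (ι d)) l (ι d)) →
    (∀ {c d} → Adj N (ι c) (ι d) → ¬ Star (AvoidEdge N (ι c) (ι d)) (ι c) (ι d)) →
    NoDetour N
  noDetour-by-cases simple at-l between {a} {b} a~b detour with view a | view b
  ... | new   | new   = proj₁ simple l a~b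
  ... | new   | old d = at-l a~b detour
  ... | old c | new   = at-l (adj-sym simple a~b) (reverse-detour simple detour)
  ... | old c | old d = between a~b detour

  squash-detour : ∀ {N : Graph (suc m)} {G : Graph m} → IsSimpleGraph N → IsSimpleGraph G →
    ∀ {a b a′ b′} (z : Fin m) →
    (∀ {e} → AvoidEdge N a b l (ι e) → e ≡ z ⊎ AvoidEdge G a′ b′ z e) →
    (∀ {e f} → AvoidEdge N a b (ι e) (ι f) → AvoidEdge G a′ b′ e f) →
    Star (AvoidEdge N a b) a b → Star (AvoidEdge G a′ b′) (squash z a) (squash z b)
  squash-detour simpleN simpleG z at-l between =
    squash-star z (avoid-sym simpleN) (avoid-sym simpleG) (proj₁ simpleN l ∘ proj₁) at-l between
    where
    avoid-sym : ∀ {n} {E : Graph n} {a b} → IsSimpleGraph E →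
      ∀ {u v} → AvoidEdge E a b u v → AvoidEdge E a b v u
    avoid-sym simple (e , ¬s) = adj-sym simple e , ¬s ∘ SameEdge-swap

  backbone-membership : ∀ {N : Graph (suc m)} {G : Graph m} {bb bb′} →
    (∀ c → Leaf N (ι c) ⇔ Leaf G c) → (∀ c → c ∈ bb ⇔ (¬ Leaf G c)) →
    (∀ c → ι c ∈ bb′ ⇔ c ∈ bb) → (l ∈ bb′ ⇔ (¬ Leaf N l)) →
    ∀ v → v ∈ bb′ ⇔ (¬ Leaf N v)
  backbone-membership leaf⇔ bb⇔ ι∈⇔ l∈⇔ v with view v
  ... | new   = l∈⇔
  ... | old c = mk⇔ (λ ιc∈ leaf → to (bb⇔ c) (to (ι∈⇔ c) ιc∈) (to (leaf⇔ c) leaf))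
                    (λ ¬leaf → from (ι∈⇔ c) (from (bb⇔ c) (¬leaf ∘ from (leaf⇔ c))))

  ι∈map-ι : ∀ {c} bb → ι c ∈ map ι bb ⇔ c ∈ bb
  ι∈map-ι bb = mk⇔
    (λ ιc∈ → let _ , c′∈ , ιc≡ιc′ = ∈-map⁻ ι ιc∈ in subst (_∈ bb) (sym (ι-injective ιc≡ιc′)) c′∈)
    (∈-map⁺ ι)

  l∉map-ι : ∀ bb → l ∉ map ι bb
  l∉map-ι bb l∈ = let c , _ , l≡ιc = ∈-map⁻ ι l∈ in ι≢l c (sym l≡ιc)

  map-ι-unique : ∀ {bb} → Unique bb → Unique (map ι bb)
  map-ι-unique = Unique.map⁺ ι-injective

module PendantLeaf {m : ℕ} (l : Fin (suc m)) (G : Graph m) (j : Fin m) where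
  open Extension l

  at-j : Fin m → Bool
  at-j d = does (d ≟ j)

  attach : Graph (suc m)
  attach = ext G at-j

  deg-attach-l : deg attach l ≡ 1
  deg-attach-l = trans (deg-ext-l G at-j) (count-≟ j)

  deg-attach-ι : ∀ c → deg attach (ι c) ≡ bit (at-j c) + deg G c
  deg-attach-ι = deg-ext-ι G at-j

  l~ι⇒≡j : ∀ {d} → Adj attach l (ι d) → d ≡ j
  l~ι⇒≡j {d} = does-witness (d ≟ j) ∘ subst T (ext-lι G at-j d)

  attach-connected : Connected G → Connected attach
  attach-connected connected =
    ext-connected G at-j j (does-intro (j ≟ j) refl) connected
      λ c~d → subst T (sym (ext-ιι G at-j _ _)) c~d ◅ ε

  attach-simple : IsSimpleGraph G → IsSimpleGraph attach
  attach-simple = ext-simple G at-j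

  attach-noDetour : IsSimpleGraph G → NoDetour G → NoDetour attach
  attach-noDetour simple noDetour = noDetour-by-cases simple′ at-l between
    where
    simple′ : IsSimpleGraph attach
    simple′ = attach-simple simple
    -- l has a single neighbour, so no walk leaves l avoiding the edge at l.
    at-l : ∀ {d} → Adj attach l (ι d) → ¬ Star (AvoidEdge attach l (ι d)) l (ι d)
    at-l {d} l~ιd detour = ι≢l d (sym (star-from-sink sink detour))
      where
      sink : ∀ w → ¬ AvoidEdge attach l (ι d) l w
      sink w (l~w , ¬same) with view w
      ... | new   = proj₁ simple′ l l~w
      ... | old e = ¬same (inj₁ (refl , cong ι (trans (l~ι⇒≡j l~w) (sym (l~ι⇒≡j l~ιd)))))
    between : ∀ {c d} → Adj attach (ι c) (ι d) → ¬ Star (AvoidEdge attach (ι c) (ι d)) (ι c) (ι d)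
    between {c} {d} ιc~ιd detour =
      noDetour (subst T (ext-ιι G at-j c d) ιc~ιd)
        (subst₂ (Star _) (squash-ι j c) (squash-ι j d)
          (squash-detour simple′ simple j (λ (l~ιe , _) → inj₁ (l~ι⇒≡j l~ιe))
            (λ (ιe~ιf , ¬same) → subst T (ext-ιι G at-j _ _) ιe~ιf , ¬same ∘ SameEdge-map ι) detour))

  module _ (j-internal : 2 ≤ deg G j) where

    deg-attach-ι≢j : ∀ {c} → c ≢ j → deg attach (ι c) ≡ deg G c
    deg-attach-ι≢j {c} c≢j =
      trans (deg-attach-ι c) (cong (λ b → bit b + deg G c) (dec-false (c ≟ j) c≢j))

    leaf-attach⇔ : ∀ c → Leaf attach (ι c) ⇔ Leaf G c
    leaf-attach⇔ c with c ≟ j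
    ... | no c≢j   = mk⇔ (trans (sym (deg-attach-ι≢j c≢j))) (trans (deg-attach-ι≢j c≢j))
    ... | yes refl = mk⇔
      (λ leaf → ⊥-elim (2≤⇒≢1 (m≤n⇒m≤1+n j-internal) (trans (sym ιj-deg) leaf)))
      (λ leaf → ⊥-elim (2≤⇒≢1 j-internal leaf))
      where
      ιj-deg : deg attach (ι j) ≡ suc (deg G j)
      ιj-deg = trans (deg-attach-ι j) (cong (λ b → bit b + deg G j) (dec-true (j ≟ j) refl))

    attach-backbone : ∀ {bb} → IsBackbone G bb → IsBackbone attach (map ι bb)
    attach-backbone {bb} (unique , linked , bb⇔) =
      map-ι-unique unique ,
      Linkedₚ.map⁺ (Linked.map (subst T (sym (ext-ιι G at-j _ _))) linked) ,
      backbone-membership {attach} {G} leaf-attach⇔ bb⇔ (λ _ → ι∈map-ι bb)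
        (mk⇔ (⊥-elim ∘ l∉map-ι bb) (λ ¬leaf → ⊥-elim (¬leaf deg-attach-l)))

module Subdivision {m : ℕ} (l : Fin (suc m)) (G : Graph m) (x y : Fin m) where
  open Extension l

  removeEdge : Graph m
  removeEdge p q = G p q ∧ not (does (sameEdge? x y p q))

  removeEdge-on : ∀ {p q} → SameEdge x y p q → removeEdge p q ≡ false
  removeEdge-on {p} {q} s rewrite dec-true (sameEdge? x y p q) s = ∧-zeroʳ (G p q)

  removeEdge-off : ∀ {p q} → ¬ SameEdge x y p q → removeEdge p q ≡ G p q
  removeEdge-off {p} {q} ¬s rewrite dec-false (sameEdge? x y p q) ¬s = ∧-identityʳ (G p q)

  removeEdge⇔avoid : ∀ {p q} → Adj removeEdge p q ⇔ AvoidEdge G x y p q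
  removeEdge⇔avoid {p} {q} = mk⇔ avoid (λ (p~q , ¬s) → subst T (sym (removeEdge-off ¬s)) p~q)
    where
    avoid : Adj removeEdge p q → AvoidEdge G x y p q
    avoid p~q with sameEdge? x y p q
    ... | yes s  = ⊥-elim (subst T (removeEdge-on s) p~q)
    ... | no  ¬s = subst T (removeEdge-off ¬s) p~q , ¬s

  removeEdge-simple : IsSimpleGraph G → IsSimpleGraph removeEdge
  removeEdge-simple (loopless , symmetric) =
    (λ u → loopless u ∘ proj₁ ∘ to removeEdge⇔avoid) , symmetric′
    where
    symmetric′ : ∀ p q → removeEdge p q ≡ removeEdge q p
    symmetric′ p q with sameEdge? x y p q
    ... | yes s  = trans (removeEdge-on s) (sym (removeEdge-on (SameEdge-swap s)))
    ... | no  ¬s =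
      trans (removeEdge-off ¬s) (trans (symmetric p q) (sym (removeEdge-off (¬s ∘ SameEdge-swap))))

  at-xy : Fin m → Bool
  at-xy d = does ((d ≟ x) ⊎-dec (d ≟ y))

  subdivide : Graph (suc m)
  subdivide = ext removeEdge at-xy

  l~ι⇒xy : ∀ {d} → Adj subdivide l (ι d) → d ≡ x ⊎ d ≡ y
  l~ι⇒xy {d} = does-witness ((d ≟ x) ⊎-dec (d ≟ y)) ∘ subst T (ext-lι removeEdge at-xy d)

  xy⇒l~ι : ∀ {d} → d ≡ x ⊎ d ≡ y → Adj subdivide l (ι d)
  xy⇒l~ι {d} = subst T (sym (ext-lι removeEdge at-xy d)) ∘ does-intro ((d ≟ x) ⊎-dec (d ≟ y))

  xy⇒ι~l : ∀ {d} → d ≡ x ⊎ d ≡ y → Adj subdivide (ι d) l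
  xy⇒ι~l {d} = subst T (sym (ext-ιl removeEdge at-xy d)) ∘ does-intro ((d ≟ x) ⊎-dec (d ≟ y))

  ι~ι⇔avoid : ∀ {e f} → Adj subdivide (ι e) (ι f) ⇔ AvoidEdge G x y e f
  ι~ι⇔avoid {e} {f} = mk⇔ (to removeEdge⇔avoid ∘ subst T (ext-ιι removeEdge at-xy e f))
                          (subst T (sym (ext-ιι removeEdge at-xy e f)) ∘ from removeEdge⇔avoid)

  module OnEdge (x≢y : x ≢ y) (simple : IsSimpleGraph G) (x~y : Adj G x y) where

    SameEdge-adj : ∀ {p q} → SameEdge x y p q → Adj G p q
    SameEdge-adj (inj₁ (refl , refl)) = x~y
    SameEdge-adj (inj₂ (refl , refl)) = adj-sym simple x~y

    deg-subdivide-l : deg subdivide l ≡ 2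
    deg-subdivide-l = trans (deg-ext-l removeEdge at-xy) (count-≟-⊎ x≢y)

    count-removeEdge : ∀ c → bit (at-xy c) + count (removeEdge c) ≡ count (G c)
    count-removeEdge c = by-cases (c ≟ x) (c ≟ y)
      where
      end : c ≡ x ⊎ c ≡ y → bit (at-xy c) + count (removeEdge c) ≡ suc (count (removeEdge c))
      end c∈ = cong (λ b → bit b + count (removeEdge c)) (dec-true ((c ≟ x) ⊎-dec (c ≟ y)) c∈)
      by-cases : Dec (c ≡ x) → Dec (c ≡ y) → bit (at-xy c) + count (removeEdge c) ≡ count (G c)
      by-cases (yes refl) _ = trans (end (inj₁ refl)) (sym
        (count-drop y (to T-≡ x~y) (removeEdge-on (inj₁ (refl , refl)))
          λ q q≢y → sym (removeEdge-off (SameEdge-endpoint (inj₂ refl) (x≢y ∘ sym) (q≢y ∘ sym)))))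
      by-cases (no _) (yes refl) = trans (end (inj₂ refl)) (sym
        (count-drop x (to T-≡ (adj-sym simple x~y)) (removeEdge-on (inj₂ (refl , refl)))
          λ q q≢x → sym (removeEdge-off (SameEdge-endpoint (inj₁ refl) x≢y (q≢x ∘ sym)))))
      by-cases (no c≢x) (no c≢y) = trans
        (cong (λ b → bit b + count (removeEdge c)) (dec-false ((c ≟ x) ⊎-dec (c ≟ y)) [ c≢x , c≢y ]))
        (count-ext {f = removeEdge c} λ q → removeEdge-off ([ c≢x , c≢y ] ∘ SameEdge-first))

    deg-subdivide-ι : ∀ c → deg subdivide (ι c) ≡ deg G c
    deg-subdivide-ι c = begin
      deg subdivide (ι c)                     ≡⟨ deg-ext-ι removeEdge at-xy c ⟩
      bit (at-xy c) + deg removeEdge c        ≡⟨ cong (bit (at-xy c) +_) (deg≡count removeEdge c) ⟩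
      bit (at-xy c) + count (removeEdge c)    ≡⟨ count-removeEdge c ⟩
      count (G c)                             ≡⟨ deg≡count G c ⟨
      deg G c                                 ∎
      where open ≡-Reasoning

    subdivide-simple : IsSimpleGraph subdivide
    subdivide-simple = ext-simple removeEdge at-xy (removeEdge-simple simple)

    subdivide-connected : Connected G → Connected subdivide
    subdivide-connected connected =
      ext-connected removeEdge at-xy x (does-intro ((x ≟ x) ⊎-dec (x ≟ y)) (inj₁ refl)) connected lift
      where
      lift : ∀ {c d} → Adj G c d → Reach subdivide (ι c) (ι d)
      lift {c} {d} c~d with sameEdge? x y c d
      ... | yes s  = xy⇒ι~l (SameEdge-first s) ◅ xy⇒l~ι (SameEdge-first (SameEdge-swap s)) ◅ ε
      ... | no  ¬s = from ι~ι⇔avoid (c~d , ¬s) ◅ ε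

    subdivide-noDetour : NoDetour G → NoDetour subdivide
    subdivide-noDetour noDetour = noDetour-by-cases subdivide-simple at-l between
      where
      -- A detour from l to ι d squashes, via l ↦ d′, onto a detour for the edge d′d of G.
      at-l : ∀ {d} → Adj subdivide l (ι d) → ¬ Star (AvoidEdge subdivide l (ι d)) l (ι d)
      at-l {d} l~ιd = no-detour-via (other-end (l~ι⇒xy l~ιd))
        where
        other-end : d ≡ x ⊎ d ≡ y → ∃[ d′ ] SameEdge x y d′ d
        other-end (inj₁ refl) = y , inj₂ (refl , refl)
        other-end (inj₂ refl) = x , inj₁ (refl , refl)
        no-detour-via : ∃[ d′ ] SameEdge x y d′ d → ¬ Star (AvoidEdge subdivide l (ι d)) l (ι d)
        no-detour-via (d′ , s) detour = noDetour (SameEdge-adj s)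
          (subst₂ (Star _) (squash-l d′) (squash-ι d′ d)
            (squash-detour subdivide-simple simple d′
              (λ (l~ιe , ¬same) →
                inj₁ (SameEdge-other-end s (l~ι⇒xy l~ιe) (¬same ∘ λ { refl → inj₁ (refl , refl) })))
              (λ ιe~ιf → let e~f , ¬xy = to ι~ι⇔avoid (proj₁ ιe~ιf) in e~f , ¬xy ∘ SameEdge-trans s)
              detour))
      -- An old-edge detour squashes, via l ↦ x, onto a detour in G.
      between : ∀ {c d} → Adj subdivide (ι c) (ι d) →
        ¬ Star (AvoidEdge subdivide (ι c) (ι d)) (ι c) (ι d)
      between {c} {d} ιc~ιd detour with to ι~ι⇔avoid ιc~ιd
      ... | c~d , ¬xy = noDetour c~d
        (subst₂ (Star _) (squash-ι x c) (squash-ι x d)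
          (squash-detour subdivide-simple simple x at-l′
            (λ (ιe~ιf , ¬same) → proj₁ (to ι~ι⇔avoid ιe~ιf) , ¬same ∘ SameEdge-map ι)
            detour))
        where
        at-l′ : ∀ {e} → AvoidEdge subdivide (ι c) (ι d) l (ι e) → e ≡ x ⊎ AvoidEdge G c d x e
        at-l′ (l~ιe , _) with l~ι⇒xy l~ιe
        ... | inj₁ e≡x  = inj₁ e≡x
        ... | inj₂ refl = inj₂ (x~y , ¬xy ∘ SameEdge-sym)

    leaf-subdivide⇔ : ∀ c → Leaf subdivide (ι c) ⇔ Leaf G c
    leaf-subdivide⇔ c = mk⇔ (trans (sym (deg-subdivide-ι c))) (trans (deg-subdivide-ι c))

    linked-avoiding : ∀ {w} → w ≡ x ⊎ w ≡ y → ∀ {Z} → Linked (Adj G) Z → All (w ≢_) Z →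
      Linked (Adj subdivide) (map ι Z)
    linked-avoiding w∈ []         _           = []
    linked-avoiding w∈ [-]        _           = [-]
    linked-avoiding w∈ (u~v ∷ lk) (w≢u ∷ w∉) =
      from ι~ι⇔avoid (u~v , SameEdge-endpoint w∈ w≢u (All.head w∉)) ∷ linked-avoiding w∈ lk w∉

    module _ {s t} (st : SameEdge x y s t) where

      s∈xy : s ≡ x ⊎ s ≡ y
      s∈xy = SameEdge-first st

      t∈xy : t ≡ x ⊎ t ≡ y
      t∈xy = SameEdge-first (SameEdge-swap st)

      linked-to-l : ∀ {a} B → LastOf a B s → Linked (Adj G) B → All (t ≢_) B →
        Linked (Adj subdivide) (map ι B ++ l ∷ [])
      linked-to-l []           _    _           _           = [-]
      linked-to-l (c ∷ [])     refl _           _           = xy⇒ι~l s∈xy ∷ [-]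
      linked-to-l (c ∷ c′ ∷ B) last (c~c′ ∷ lk) (t≢c ∷ t∉) =
        from ι~ι⇔avoid (c~c′ , SameEdge-endpoint t∈xy t≢c (All.head t∉)) ∷
        linked-to-l {c} (c′ ∷ B) last lk t∉

      linked-from-l : ∀ {b} B → FirstOf B b t → Linked (Adj G) B → All (s ≢_) B →
        Linked (Adj subdivide) (l ∷ map ι B)
      linked-from-l []      _    _  _  = [-]
      linked-from-l (c ∷ B) refl lk s∉ = xy⇒l~ι t∈xy ∷ linked-avoiding s∈xy lk s∉

    subdivide-backbone : ∀ {P} → IsSpinePath G P → PathEdge P x y → ∃[ bb ] IsBackbone subdivide bb
    subdivide-backbone (a , bb , b , refl , _ , _ , (unique-bb , linked-bb , bb⇔) , unique-P , _) xy∈P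
      with orient xy∈P
    ... | s , t , st , s~t∈P with consec-split bb s~t∈P
    ... | B₁ , B₂ , refl , last , first = bb′ , unique′ , linked′ , membership
      where
      bb′ : List (Fin (suc m))
      bb′ = map ι B₁ ++ l ∷ map ι B₂
      perm : bb′ ↭ l ∷ map ι (B₁ ++ B₂)
      perm = subst (bb′ ↭_) (cong (l ∷_) (sym (map-++ ι B₁ B₂))) (shift l (map ι B₁) (map ι B₂))
      unique′ : Unique bb′
      unique′ = unique-resp-↭ (↭-sym perm)
        (¬Any⇒All¬ _ (l∉map-ι (B₁ ++ B₂)) ∷ map-ι-unique unique-bb)
      unique-P′ : Unique ((a ∷ B₁) ++ (B₂ ++ b ∷ []))
      unique-P′ = subst Unique (cong (a ∷_) (++-assoc B₁ B₂ (b ∷ []))) unique-P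
      t∉B₁ : All (t ≢_) B₁
      t∉B₁ = All.tabulate λ c∈ t≡c →
        unique-++-disjoint (a ∷ B₁) unique-P′ (there c∈) (FirstOf-∈ B₂ first) (sym t≡c)
      s∉B₂ : All (s ≢_) B₂
      s∉B₂ = All.tabulate λ c∈ s≡c →
        unique-++-disjoint (a ∷ B₁) unique-P′ (LastOf-∈ B₁ last) (∈-++⁺ˡ c∈) s≡c
      linked′ : Linked (Adj subdivide) bb′
      linked′ = linked-join (map ι B₁)
        (linked-to-l st B₁ last (linked-++⁻ˡ B₁ linked-bb) t∉B₁)
        (linked-from-l st B₂ first (linked-++⁻ʳ B₁ linked-bb) s∉B₂)
      ι∈bb′⇔ : ∀ c → ι c ∈ bb′ ⇔ c ∈ B₁ ++ B₂
      ι∈bb′⇔ c = mk⇔ (λ ιc∈ → ι∈l∷map-ι (∈-resp-↭ perm ιc∈))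
                     (∈-resp-↭ (↭-sym perm) ∘ there ∘ from (ι∈map-ι (B₁ ++ B₂)))
        where
        ι∈l∷map-ι : ι c ∈ l ∷ map ι (B₁ ++ B₂) → c ∈ B₁ ++ B₂
        ι∈l∷map-ι (here ιc≡l) = ⊥-elim (ι≢l c ιc≡l)
        ι∈l∷map-ι (there ιc∈) = to (ι∈map-ι (B₁ ++ B₂)) ιc∈
      membership : ∀ v → v ∈ bb′ ⇔ (¬ Leaf subdivide v)
      membership = backbone-membership {subdivide} {G} leaf-subdivide⇔ bb⇔ ι∈bb′⇔
        (mk⇔ (λ _ leaf → 2≤⇒≢1 ≤-refl (trans (sym deg-subdivide-l) leaf))
             (λ _ → ∈-++⁺ʳ (map ι B₁) (here refl)))

-- Pigeonhole for f extended by r at a new point.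
injection-avoiding-covers : ∀ {k} (i : Fin (suc k)) (f : Fin k → Fin (suc k)) → (∀ t → f t ≢ i) →
  (∀ t t′ → f t ≡ f t′ → t ≡ t′) → ∀ r → r ≢ i → ∃[ t ] f t ≡ r
injection-avoiding-covers {k} i f f≢i injective r r≢i with pigeonhole (n<1+n k) squeeze
  where
  squeeze : Fin (suc k) → Fin k
  squeeze zero    = punchOut (r≢i ∘ sym)
  squeeze (suc t) = punchOut (f≢i t ∘ sym)
... | zero  , suc t  , _     , eq = t , sym (punchOut-injective (r≢i ∘ sym) (f≢i t ∘ sym) eq)
... | suc t , suc t′ , t<t′ , eq =
  ⊥-elim (<⇒≢ t<t′ (cong suc (injective t t′
    (punchOut-injective (f≢i t ∘ sym) (f≢i t′ ∘ sym) eq))))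

spine-linked : ∀ {n} {E : Graph n} {P} → IsSpinePath E P → Linked (Adj E) P
spine-linked (_ , _ , _ , _ , _ , _ , _ , _ , linked) = linked

pathEdge-adj : ∀ {n} {E : Graph n} {P x y} → IsSimpleGraph E → Linked (Adj E) P → PathEdge P x y →
  Adj E x y
pathEdge-adj simple linked (inj₁ xy) = consec-linked xy linked
pathEdge-adj simple linked (inj₂ yx) = adj-sym simple (consec-linked yx linked)

module Construction {k m : ℕ} (D : Matrix (suc k) (suc m)) (l : Fin (suc m)) (i : Fin (suc k))
  (j : Fin m) (D-positive : ∀ r v → 1 ≤ D r v) (D-il : D i l ≡ 1)
  (D-rl : ∀ r → r ≢ i → D r l ≡ 2) (D-ij : 2 < D i (punchIn l j))
  (G′ : ColouredGraph (suc k) m) (G′-realizes : CaterpillarRealization (delCol D l i j) G′)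
  (P : Fin (suc k) → List (Fin m)) (spine : ∀ r → r ≢ i → IsSpinePath (G′ r) (P r))
  (M : RainbowMatching P i j k) where

  open Extension l
  open RainbowMatching M

  G′-disjoint : ∀ r s u v → Adj (G′ r) u v → Adj (G′ s) u v → r ≡ s
  G′-disjoint = proj₂ (proj₁ (proj₁ G′-realizes))

  G′-deg : ∀ r v → deg (G′ r) v ≡ delCol D l i j r v
  G′-deg = proj₂ (proj₁ G′-realizes)

  G′-simple : ∀ r → IsSimpleGraph (G′ r)
  G′-simple r = proj₁ (proj₁ (proj₂ G′-realizes r))

  G′-connected : ∀ r → Connected (G′ r)
  G′-connected r = proj₁ (proj₂ (proj₁ (proj₂ G′-realizes r)))

  G′-noDetour : ∀ r → NoDetour (G′ r)
  G′-noDetour r = acyclic⇒noDetour (G′-simple r) (proj₂ (proj₂ (proj₁ (proj₂ G′-realizes r))))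

  G′-backbone : ∀ r → ∃[ bb ] IsBackbone (G′ r) bb
  G′-backbone r = proj₂ (proj₂ G′-realizes r)

  matched : ∀ r → r ≢ i → Fin k
  matched r r≢i = proj₁ (injection-avoiding-covers i col colOk rainbow r r≢i)

  col-matched : ∀ r r≢i → col (matched r r≢i) ≡ r
  col-matched r r≢i = proj₂ (injection-avoiding-covers i col colOk rainbow r r≢i)

  newColour : ∀ r → Dec (r ≡ i) → Graph (suc m)
  newColour r (yes _)   = PendantLeaf.attach l (G′ r) j
  newColour r (no  r≢i) = Subdivision.subdivide l (G′ r) (end₁ (matched r r≢i)) (end₂ (matched r r≢i))

  G : ColouredGraph (suc k) (suc m)
  G r = newColour r (r ≟ i)

  delCol-i : ∀ c → delCol D l i j i c ≡ D i (ι c) ∸ bit (does (c ≟ j))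
  delCol-i c rewrite dec-true (i ≟ i) refl = refl

  delCol-≢i : ∀ {r} → r ≢ i → ∀ c → delCol D l i j r c ≡ D r (ι c)
  delCol-≢i r≢i c rewrite dec-false (_ ≟ i) r≢i = refl

  ColourClass : Fin (suc k) → Graph (suc m) → Set
  ColourClass r N = IsSimpleGraph N × (∀ v → deg N v ≡ D r v) × IsCaterpillar N

  newColour-class : ∀ r dr → ColourClass r (newColour r dr)
  newColour-class r (yes refl) =
    simple′ , deg′ , (simple′ , attach-connected (G′-connected i) , acyclic′) ,
    _ , attach-backbone j-internal (proj₂ (G′-backbone i))
    where
    open PendantLeaf l (G′ i) j
    simple′ : IsSimpleGraph attach
    simple′ = attach-simple (G′-simple i)
    acyclic′ : Acyclic attach
    acyclic′ = noDetour⇒acyclic simple′ (attach-noDetour (G′-simple i) (G′-noDetour i))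
    deg′ : ∀ v → deg attach v ≡ D i v
    deg′ v with view v
    ... | new   = trans deg-attach-l (sym D-il)
    ... | old c = begin
      deg attach (ι c)
        ≡⟨ deg-attach-ι c ⟩
      bit (at-j c) + deg (G′ i) c
        ≡⟨ cong (bit (at-j c) +_) (trans (G′-deg i c) (delCol-i c)) ⟩
      bit (at-j c) + (D i (ι c) ∸ bit (at-j c))
        ≡⟨ bit+∸bit (at-j c) (D-positive i (ι c)) ⟩
      D i (ι c) ∎
      where open ≡-Reasoning
    deg-j : deg (G′ i) j ≡ D i (ι j) ∸ 1
    deg-j = trans (G′-deg i j) (trans (delCol-i j) (cong (λ b → D i (ι j) ∸ bit b) (dec-true (j ≟ j) refl)))
    j-internal : 2 ≤ deg (G′ i) j
    j-internal = subst (2 ≤_) (sym deg-j) (∸-monoˡ-≤ 1 D-ij)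
  newColour-class r (no r≢i) =
    subdivide-simple , deg′ , (subdivide-simple , subdivide-connected (G′-connected r) , acyclic′) ,
    subdivide-backbone (spine r r≢i) xy∈P
    where
    t : Fin k
    t = matched r r≢i
    open Subdivision l (G′ r) (end₁ t) (end₂ t)
    xy∈P : PathEdge (P r) (end₁ t) (end₂ t)
    xy∈P = subst (λ c → PathEdge (P c) (end₁ t) (end₂ t)) (col-matched r r≢i) (inPath t)
    x~y : Adj (G′ r) (end₁ t) (end₂ t)
    x~y = pathEdge-adj (G′-simple r) (spine-linked (spine r r≢i)) xy∈P
    open Subdivision.OnEdge l (G′ r) (end₁ t) (end₂ t) (disj₁₂ t t) (G′-simple r) x~y
    acyclic′ : Acyclic subdivide
    acyclic′ = noDetour⇒acyclic subdivide-simple (subdivide-noDetour (G′-noDetour r))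
    deg′ : ∀ v → deg subdivide v ≡ D r v
    deg′ v with view v
    ... | new   = trans deg-subdivide-l (sym (D-rl r r≢i))
    ... | old c = trans (deg-subdivide-ι c) (trans (G′-deg r c) (delCol-≢i r≢i c))

  Attached : ∀ r → Dec (r ≡ i) → Fin m → Set
  Attached r (yes _)   d = d ≡ j
  Attached r (no r≢i) d = d ≡ end₁ (matched r r≢i) ⊎ d ≡ end₂ (matched r r≢i)

  l~ι⇒attached : ∀ r dr {d} → Adj (newColour r dr) l (ι d) → Attached r dr d
  l~ι⇒attached r (yes _)   = PendantLeaf.l~ι⇒≡j l (G′ r) j
  l~ι⇒attached r (no r≢i) = Subdivision.l~ι⇒xy l (G′ r) _ _

  ι~ι⇒old : ∀ r dr {c d} → Adj (newColour r dr) (ι c) (ι d) → Adj (G′ r) c d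
  ι~ι⇒old r (yes _)   {c} {d} = subst T (ext-ιι (G′ r) (PendantLeaf.at-j l (G′ r) j) c d)
  ι~ι⇒old r (no r≢i)         = proj₁ ∘ to (Subdivision.ι~ι⇔avoid l (G′ r) _ _)

  same-matched : ∀ {r s} r≢i s≢i → matched r r≢i ≡ matched s s≢i → r ≡ s
  same-matched {r} {s} r≢i s≢i eq = trans (sym (col-matched r r≢i)) (trans (cong col eq) (col-matched s s≢i))

  -- Holds because the matching is rainbow, avoids j and has pairwise disjoint edges.
  attached-unique : ∀ r s dr ds {d} → Attached r dr d → Attached s ds d → r ≡ s
  attached-unique r s (yes r≡i) (yes s≡i) _ _ = trans r≡i (sym s≡i)
  attached-unique r s (yes _) (no s≢i) refl (inj₁ e) = ⊥-elim (avoid₁ (matched s s≢i) (sym e))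
  attached-unique r s (yes _) (no s≢i) refl (inj₂ e) = ⊥-elim (avoid₂ (matched s s≢i) (sym e))
  attached-unique r s (no r≢i) (yes _) (inj₁ refl) e = ⊥-elim (avoid₁ (matched r r≢i) e)
  attached-unique r s (no r≢i) (yes _) (inj₂ refl) e = ⊥-elim (avoid₂ (matched r r≢i) e)
  attached-unique r s (no r≢i) (no s≢i) (inj₁ refl) (inj₁ e) = same-matched r≢i s≢i (disj₁₁ _ _ e)
  attached-unique r s (no r≢i) (no s≢i) (inj₂ refl) (inj₂ e) = same-matched r≢i s≢i (disj₂₂ _ _ e)
  attached-unique r s (no r≢i) (no s≢i) (inj₁ refl) (inj₂ e) = ⊥-elim (disj₁₂ _ _ e)
  attached-unique r s (no r≢i) (no s≢i) (inj₂ refl) (inj₁ e) = ⊥-elim (disj₁₂ _ _ (sym e))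

  newColour-disjoint : ∀ r s dr ds u v → Adj (newColour r dr) u v → Adj (newColour s ds) u v → r ≡ s
  newColour-disjoint r s dr ds u v u~ᵣv u~ₛv with view u | view v
  ... | new   | new   = ⊥-elim (proj₁ (proj₁ (newColour-class r dr)) l u~ᵣv)
  ... | new   | old d = attached-unique r s dr ds (l~ι⇒attached r dr u~ᵣv) (l~ι⇒attached s ds u~ₛv)
  ... | old c | new   = attached-unique r s dr ds
    (l~ι⇒attached r dr (adj-sym (proj₁ (newColour-class r dr)) u~ᵣv))
    (l~ι⇒attached s ds (adj-sym (proj₁ (newColour-class s ds)) u~ₛv))
  ... | old c | old d = G′-disjoint r s c d (ι~ι⇒old r dr u~ᵣv) (ι~ι⇒old s ds u~ₛv)

  G-realizes : CaterpillarRealization D G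
  G-realizes =
    (((λ r → proj₁ (class r)) , (λ r s → newColour-disjoint r s (r ≟ i) (s ≟ i))) ,
     (λ r → proj₁ (proj₂ (class r)))) ,
    (λ r → proj₂ (proj₂ (class r)))
    where
    class : ∀ r → ColourClass r (G r)
    class r = newColour-class r (r ≟ i)

mainTheorem9 : ∀ {k m} (D : Matrix k (suc m)) (l : Fin (suc m)) (i : Fin k) (j : Fin m) →
    TreeDegreeMatrix D → NoCommonLeaves D →
    D i l ≡ 1 → (∀ r → r ≢ i → D r l ≡ 2) →
    2 < D i (punchIn l j) →
    TreeDegreeMatrix (delCol D l i j) → NoCommonLeaves (delCol D l i j) →
    (G' : ColouredGraph k m) → CaterpillarRealization (delCol D l i j) G' →
    (P : Fin k → List (Fin m)) → (∀ r → r ≢ i → IsSpinePath (G' r) (P r)) →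
    RainbowMatching P i j (k ∸ 1) →
    ∃[ G ] CaterpillarRealization D G
mainTheorem9 {zero}  D l () j
mainTheorem9 {suc k} D l i j D-tree _ D-il D-rl D-ij _ _ G′ G′-realizes P spine M =
  G , G-realizes
  where open Construction D l i j (λ r → proj₁ (D-tree r)) D-il D-rl D-ij G′ G′-realizes P spine M
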